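{- Let $\mathcal M=(W,W^\bot,\preccurlyeq,\sqsubseteq,V)$ be any bi-intuitionistic model, $w\in W$ and $\varphi\in\mathcal L$. (1) If $\mathcal M$ is forth--up confluent, then $(\mathcal M,w)\models\Diamond\varphi$ if and only if there exists $v$ with $w\sqsubseteq v$ and $(\mathcal M,v)\models\varphi$. (2) If $\mathcal M$ is forth--down confluent, then $(\mathcal M,w)\models\Box\varphi$ if and only if for all $v$ with $w\sqsubseteq v$ we have $(\mathcal M,v)\models\varphi$.
   Context: Language $\mathcal L$ over countably many propositional variables $\mathbb P$: $\varphi ::= p \mid \bot \mid \varphi\wedge\varphi\mid\varphi\vee\varphi\mid\varphi\to\varphi\mid\Diamond\varphi\mid\Box\varphi$. A bi-intuitionistic frame $(W,W^\bot,\preccurlyeq,\sqsubseteq)$ has preorders $\preccurlyeq,\sqsubseteq$ on $W$ and $W^\bot\subseteq W$ closed upward under both. Forth--up confluent: $w\preccurlyeq w'$, $w\sqsubseteq v$ imply some $v'$ with $v\preccurlyeq v'$, $w'\sqsubseteq v'$. Forth--down confluent: $w\preccurlyeq v\sqsubseteq v'$ implies some $w'$ with $w\sqsubseteq w'\preccurlyeq v'$. A bi-intuitionistic model is such a frame with a valuation $V:\mathbb P\to2^W$, each $V(p)$ $\preccurlyeq$-upward closed and containing $W^\bot$; a model has a property if its frame does. Satisfaction: $w\models p$ iff $w\in V(p)$; $w\models\bot$ iff $w\in W^\bot$; $\wedge,\vee$ pointwise; $w\models\varphi\to\psi$ iff for all $v\succcurlyeq w$, $v\models\varphi$ implies $v\models\psi$;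 $w\models\Diamond\varphi$ iff for all $u\succcurlyeq w$ there is $v\sqsupseteq u$ with $v\models\varphi$; $w\models\Box\varphi$ iff for all $u,v$ with $w\preccurlyeq u\sqsubseteq v$, $v\models\varphi$. -}

module Defs where

open import Data.Nat using (ℕ)
open import Data.Product using (Σ; ∃; _×_; _,_)
open import Data.Sum using (_⊎_)
open import Relation.Binary.PropositionalEquality using (_≡_)
open import Relation.Binary.Structures using (IsPreorder)

ℙ : Set
ℙ = ℕ

data Form : Set where
  var  : ℙ → Form
  ⊥'   : Form
  _∧'_ : Form → Form → Form
  _∨'_ : Form → Form → Form
  _⇒'_ : Form → Form → Form
  ◇    : Form → Form
  □    : Form → Form

record BiFrame : Set₁ where
  field
    W       : Set
    W⊥      : W → Set
    _≼_     : W → W → Set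
    _⊑_     : W → W → Set
    ≼-pre   : IsPreorder _≡_ _≼_
    ⊑-pre   : IsPreorder _≡_ _⊑_
    W⊥-up≼  : ∀ {w v} → w ≼ v → W⊥ w → W⊥ v
    W⊥-up⊑  : ∀ {w v} → w ⊑ v → W⊥ w → W⊥ v

record BiModel : Set₁ where
  field
    frame : BiFrame
  open BiFrame frame public
  field
    V      : ℙ → W → Set
    V-up   : ∀ p {w v} → w ≼ v → V p w → V p v
    V-⊥    : ∀ p {w} → W⊥ w → V p w

module _ (F : BiFrame) where
  open BiFrame F

  ForthUpConfluent : Set
  ForthUpConfluent = ∀ {w w' v} → w ≼ w' → w ⊑ v →
    Σ W λ v' → (v ≼ v') × (w' ⊑ v')

  ForthDownConfluent : Set
  ForthDownConfluent = ∀ {w v v'} → w ≼ v → v ⊑ v' →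
    Σ W λ w' → (w ⊑ w') × (w' ≼ v')

module _ (M : BiModel) where
  open BiModel M

  _⊨_ : W → Form → Set
  w ⊨ var p    = V p w
  w ⊨ ⊥'       = W⊥ w
  w ⊨ (φ ∧' ψ) = (w ⊨ φ) × (w ⊨ ψ)
  w ⊨ (φ ∨' ψ) = (w ⊨ φ) ⊎ (w ⊨ ψ)
  w ⊨ (φ ⇒' ψ) = ∀ v → w ≼ v → v ⊨ φ → v ⊨ ψ
  w ⊨ ◇ φ      = ∀ u → w ≼ u → Σ W λ v → (u ⊑ v) × (v ⊨ φ)
  w ⊨ □ φ      = ∀ u v → w ≼ u → u ⊑ v → v ⊨ φ

module Submission where

open import Defs
open import Data.Product using (Σ; _×_; _,_)
open import Data.Sum using (inj₁; inj₂)
open import Function.Bundles using (_⇔_; mk⇔)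
open import Relation.Binary.Structures using (IsPreorder)

module _ (M : BiModel) where
  open BiModel M
  open IsPreorder ≼-pre using () renaming (refl to ≼-refl; trans to ≼-trans)

  ⊨-mono-≼ : ∀ φ {w v} → w ≼ v → _⊨_ M w φ → _⊨_ M v φ
  ⊨-mono-≼ (var p)  w≼v h        = V-up p w≼v h
  ⊨-mono-≼ ⊥'       w≼v h        = W⊥-up≼ w≼v h
  ⊨-mono-≼ (φ ∧' ψ) w≼v (a , b)  = ⊨-mono-≼ φ w≼v a , ⊨-mono-≼ ψ w≼v b
  ⊨-mono-≼ (φ ∨' ψ) w≼v (inj₁ a) = inj₁ (⊨-mono-≼ φ w≼v a)
  ⊨-mono-≼ (φ ∨' ψ) w≼v (inj₂ b) = inj₂ (⊨-mono-≼ ψ w≼v b)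
  ⊨-mono-≼ (φ ⇒' ψ) w≼v h        = λ u v≼u → h u (≼-trans w≼v v≼u)
  ⊨-mono-≼ (◇ φ)    w≼v h        = λ u v≼u → h u (≼-trans w≼v v≼u)
  ⊨-mono-≼ (□ φ)    w≼v h        = λ u x v≼u → h u x (≼-trans w≼v v≼u)

  ◇-witness : ∀ {w} φ → _⊨_ M w (◇ φ) → Σ W λ v → w ⊑ v × _⊨_ M v φ
  ◇-witness {w} φ h = h w ≼-refl

  -- A ⊑-successor v of w is transported along w ≼ u to a ⊑-successor of u above v.
  ◇-intro : ForthUpConfluent frame →
            ∀ {w v} φ → w ⊑ v → _⊨_ M v φ → _⊨_ M w (◇ φ)
  ◇-intro up φ w⊑v v⊨φ u w≼u =
    let (v' , v≼v' , u⊑v') = up w≼u w⊑v in v' , u⊑v' , ⊨-mono-≼ φ v≼v' v⊨φ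

  □-elim : ∀ {w v} φ → _⊨_ M w (□ φ) → w ⊑ v → _⊨_ M v φ
  □-elim {w} {v} φ h w⊑v = h w v ≼-refl w⊑v

  -- A detour w ≼ u ⊑ v is replaced by w ⊑ w' ≼ v, so v inherits φ from w'.
  □-intro : ForthDownConfluent frame →
            ∀ {w} φ → (∀ v → w ⊑ v → _⊨_ M v φ) → _⊨_ M w (□ φ)
  □-intro down φ h u v w≼u u⊑v =
    let (w' , w⊑w' , w'≼v) = down w≼u u⊑v in ⊨-mono-≼ φ w'≼v (h w' w⊑w')

mainTheorem10 : (M : BiModel) → (w : BiModel.W M) → (φ : Form) →
    (ForthUpConfluent (BiModel.frame M) →
    (_⊨_ M w (◇ φ) ⇔ Σ (BiModel.W M) (λ v → BiModel._⊑_ M w v × _⊨_ M v φ)))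
    × (ForthDownConfluent (BiModel.frame M) →
    (_⊨_ M w (□ φ) ⇔ (∀ v → BiModel._⊑_ M w v → _⊨_ M v φ)))
mainTheorem10 M w φ =
    (λ up → mk⇔ (◇-witness M φ) (λ (v , w⊑v , v⊨φ) → ◇-intro M up φ w⊑v v⊨φ))
  , (λ down → mk⇔ (λ h v → □-elim M φ h) (□-intro M down φ))
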